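{- Let $\mathcal G$ be a $\mathcal P$-graph with target function $\mathcal T$, and let $\Sigma$ be a transitive partition complying with $\mathcal G$ via the bijection $q\mapsto q^{(\bullet)}$ from $\mathcal P$ onto $\Sigma$. Then (a) $\mathrm{rk}(q^{(\bullet)})\le h(q)$ for every well-founded place $q\in\mathcal P$; (b) $\mathrm{rk}(\bigcup B^{(\bullet)})\le h(B)$ for every well-founded node $B$, where $B^{(\bullet)}=\{q^{(\bullet)}:q\in B\}$.
   Context: $\mathcal P$ is a finite set of places; nodes are subsets of $\mathcal P$. A $\mathcal P$-graph is the directed bipartite graph whose edges are the membership edges $q\to B$ for $q\in B\subseteq\mathcal P$ and the distribution edges $B\to t$ for $t\in\mathcal T(B)$, where $\mathcal T:\mathcal P(\mathcal P)\to\mathcal P(\mathcal P)$ is the target function. For a family $\Gamma$ of sets, $\mathcal P^*(\Gamma)=\{s\subseteq\bigcup\Gamma: s\cap\gamma\neq\emptyset\ \forall\gamma\in\Gamma\}$. A partition $\Sigma$ (collection of pairwise disjoint nonempty sets) with $|\Sigma|=|\mathcal P|$ complies with $\mathcal G$ via a bijection $q\mapsto q^{(\bullet)}$ of $\mathcal P$ onto $\Sigma$ if $\mathcal T(B)=\{q\in\mathcal P: q^{(\bullet)}\cap\mathcal P^*(B^{(\bullet)})\neq\emptyset\}$ for every $B\subseteq\mathcal P$; it is transitive if $\bigcup\Sigma$ is a transitive set. The well-founded vertices form the least set $S$ of vertices such that any vertex all of whose immediate predecessors lie in $S$ belongs to $S$. On well-founded vertices the height is defined by $h(\emptyset)=0$,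 $h(B)=\max\{h(q):q\in B\}$ for nonempty well-founded nodes $B$, and $h(q)=\max\{h(B): q\in\mathcal T(B)\}+1$ for well-founded places $q$. $\mathrm{rk}$ denotes von Neumann rank. -}

module Defs where

open import Level using (0ℓ)
open import Data.Nat using (ℕ; zero; suc; _⊔_)
open import Data.Fin using (Fin)
open import Data.Fin.Subset using (Subset; _∈_; inside; outside)
open import Data.Fin.Subset.Properties using (_∈?_)
open import Data.Vec using ([]; _∷_)
open import Data.Product using (Σ; ∃; _×_; _,_)
open import Data.Empty using (⊥)
open import Relation.Nullary using (Dec; yes; no; ¬_)
open import Relation.Binary.PropositionalEquality using (_≢_)
open import Function.Bundles using (_⇔_)

-- Sets: Aczel's iterative (well-founded) sets as a model of the set universe

data V : Set₁ where
  sup : (I : Set) → (I → V) → V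

index : V → Set
index (sup I f) = I

elem : (x : V) → index x → V
elem (sup I f) = f

_≐_ : V → V → Set
sup I f ≐ sup J g =
  ((i : I) → Σ J (λ j → f i ≐ g j)) × ((j : J) → Σ I (λ i → f i ≐ g j))

_∈V_ : V → V → Set
x ∈V y = Σ (index y) (λ i → x ≐ elem y i)

-- von Neumann rank bounded by a natural number:
-- rk x ≤ k  iff  rk y + 1 ≤ k for every y ∈ x   (rk x = sup {rk y + 1 | y ∈ x})
mutual
  RankLE : V → ℕ → Set
  RankLE (sup I f) k = (i : I) → RankLT (f i) k

  RankLT : V → ℕ → Set
  RankLT x zero    = ⊥
  RankLT x (suc k) = RankLE x k

-- P-graphs with places Fin n, nodes Subset n, target function T

Target : ℕ → Set
Target n = Subset n → Subset n

-- well-founded vertices: least set S closed under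
-- "all immediate predecessors in S ⇒ in S".
-- Predecessors of a node B: places q ∈ B (membership edges q → B).
-- Predecessors of a place q: nodes B with q ∈ T B (distribution edges B → q).
mutual
  data WFPlace {n : ℕ} (T : Target n) : Fin n → Set where
    wfPlace : (q : Fin n) → ((B : Subset n) → q ∈ T B → WFNode T B) → WFPlace T q

  data WFNode {n : ℕ} (T : Target n) : Subset n → Set where
    wfNode : (B : Subset n) → ((q : Fin n) → q ∈ B → WFPlace T q) → WFNode T B

maxFin : (n : ℕ) → (Fin n → ℕ) → ℕ
maxFin zero    g = 0
maxFin (suc n) g = g Fin.zero ⊔ maxFin n (λ i → g (Fin.suc i))

maxSub : (n : ℕ) → (Subset n → ℕ) → ℕ
maxSub zero    g = g []
maxSub (suc n) g = maxSub n (λ s → g (outside ∷ s)) ⊔ maxSub n (λ s → g (inside ∷ s))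

-- value of a guarded term (0 if the guard fails, harmless under max)
guard : {A : Set} → Dec A → (A → ℕ) → ℕ
guard (yes a) f = f a
guard (no _)  f = 0

-- height on well-founded vertices:
--   h(B) = max {h(q) | q ∈ B}  (= 0 for B = ∅)
--   h(q) = max {h(B) | q ∈ T B} + 1
mutual
  hPlace : {n : ℕ} {T : Target n} {q : Fin n} → WFPlace T q → ℕ
  hPlace {n} {T} (wfPlace q f) =
    suc (maxSub n (λ B → guard (q ∈? T B) (λ p → hNode (f B p))))

  hNode : {n : ℕ} {T : Target n} {B : Subset n} → WFNode T B → ℕ
  hNode {n} {T} (wfNode B g) =
    maxFin n (λ q → guard (q ∈? B) (λ p → hPlace (g q p)))

-- Partitions indexed by the places: σ q is q^(•); Σ = image of σ

bigUnionNode : {n : ℕ} → (Fin n → V) → Subset n → V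
bigUnionNode {n} σ B =
  sup (Σ (Fin n) (λ q → (q ∈ B) × index (σ q)))
      (λ { (q , _ , i) → elem (σ q) i })

InPStar : {n : ℕ} → (Fin n → V) → Subset n → V → Set₁
InPStar {n} σ B s =
  ((x : V) → x ∈V s → x ∈V bigUnionNode σ B)
  × ((q : Fin n) → q ∈ B → ∃ λ x → x ∈V s × x ∈V σ q)

-- Σ = {σ q} is a partition with |Σ| = |P| and q ↦ σ q a bijection onto Σ
IsPartition : {n : ℕ} → (Fin n → V) → Set₁
IsPartition {n} σ =
  ((q : Fin n) → ∃ λ x → x ∈V σ q)
  × ((p q : Fin n) → p ≢ q → (x : V) → x ∈V σ p → x ∈V σ q → ⊥)

IsTransitive : {n : ℕ} → (Fin n → V) → Set₁
IsTransitive {n} σ =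
  (x y : V) → (∃ λ q → x ∈V σ q) → y ∈V x → ∃ λ p → y ∈V σ p

Complies : {n : ℕ} → Target n → (Fin n → V) → Set₁
Complies {n} T σ =
  (B : Subset n) (q : Fin n) → (q ∈ T B) ⇔ (∃ λ s → s ∈V σ q × InPStar σ B s)

-- Let s ∈ q^(•). By transitivity
-- every element of s lies in some block, so s ⊆ ⋃ B_s^(•) where B_s is the set of
-- places whose block meets s; hence s ∈ P*(B_s^(•)), and compliance gives
-- q ∈ T(B_s), i.e. B_s is a predecessor of q. Therefore
-- rk s ≤ rk ⋃ B_s^(•) ≤ h(B_s) < h(q). For a node B, ⋃ B^(•) has rank the maximum
-- of rk q^(•) over q ∈ B, bounded by h(B). Excluded middle is only used to form B_s.
module Submission where

open import Defs
open import Level using (0ℓ)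
open import Axiom.ExcludedMiddle using (ExcludedMiddle)
open import Data.Bool.Properties using (T-≡)
open import Data.Nat using (ℕ; zero; suc; _≤_; _<_; s≤s)
open import Data.Nat.Properties using (≤-refl; ≤-reflexive; ≤-trans; m≤m⊔n; m≤n⊔m)
open import Data.Fin using (Fin)
open import Data.Fin.Subset using (Subset; _∈_; inside; outside)
open import Data.Fin.Subset.Properties using (_∈?_)
open import Data.Vec using ([]; _∷_; tabulate; lookup)
open import Data.Vec.Properties using (lookup∘tabulate; lookup⇒[]=; []=⇒lookup)
open import Data.Vec.Properties.WithK using ([]=-irrelevant)
open import Data.Product using (_×_; Σ; ∃; _,_)
open import Relation.Nullary using (Dec; Irrelevant)
open import Relation.Nullary.Decidable using (isYes; dec-yes-irr; toWitness; fromWitness)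
open import Relation.Unary using (Pred; Decidable)
open import Relation.Binary.PropositionalEquality using (_≡_; refl; sym; trans)
open import Function using (_∘_)
open import Function.Bundles using (Equivalence)

≐-refl : (x : V) → x ≐ x
≐-refl (sup I f) = (λ i → i , ≐-refl (f i)) , (λ i → i , ≐-refl (f i))

≐-sym : (x y : V) → x ≐ y → y ≐ x
≐-sym (sup I f) (sup J g) (f⊑g , g⊑f) =
  (λ j → let (i , e) = g⊑f j in i , ≐-sym (f i) (g j) e) ,
  (λ i → let (j , e) = f⊑g i in j , ≐-sym (f i) (g j) e)

≐-trans : (x y z : V) → x ≐ y → y ≐ z → x ≐ z
≐-trans (sup I f) (sup J g) (sup K h) (f⊑g , g⊑f) (g⊑h , h⊑g) =
  (λ i → let (j , e) = f⊑g i ; (k , e′) = g⊑h j in k , ≐-trans (f i) (g j) (h k) e e′) ,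
  (λ k → let (j , e′) = h⊑g k ; (i , e) = g⊑f j in i , ≐-trans (f i) (g j) (h k) e e′)

∈V-respˡ-≐ : {x y : V} (z : V) → x ≐ y → y ∈V z → x ∈V z
∈V-respˡ-≐ {x} {y} z x≐y (i , y≐zᵢ) = i , ≐-trans x y (elem z i) x≐y y≐zᵢ

elem-∈V : (x : V) (i : index x) → elem x i ∈V x
elem-∈V x i = i , ≐-refl (elem x i)

_⊆V_ : V → V → Set₁
x ⊆V y = (z : V) → z ∈V x → z ∈V y

mutual
  RankLE-resp-≐ : (x y : V) (k : ℕ) → x ≐ y → RankLE x k → RankLE y k
  RankLE-resp-≐ (sup I f) (sup J g) k (_ , g⊑f) rk j =
    let (i , e) = g⊑f j in RankLT-resp-≐ (f i) (g j) k e (rk i)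

  RankLT-resp-≐ : (x y : V) (k : ℕ) → x ≐ y → RankLT x k → RankLT y k
  RankLT-resp-≐ x y (suc k) = RankLE-resp-≐ x y k

mutual
  RankLE-mono : (x : V) {k l : ℕ} → k ≤ l → RankLE x k → RankLE x l
  RankLE-mono (sup I f) k≤l rk i = RankLT-mono (f i) k≤l (rk i)

  RankLT-mono : (x : V) {k l : ℕ} → k ≤ l → RankLT x k → RankLT x l
  RankLT-mono x (s≤s k≤l) = RankLE-mono x k≤l

RankLE-∈V : {x y : V} {k : ℕ} → RankLE y k → x ∈V y → RankLT x k
RankLE-∈V {x} {sup J g} {k} rk (j , x≐gⱼ) = RankLT-resp-≐ (g j) x k (≐-sym x (g j) x≐gⱼ) (rk j)

RankLE-intro : (x : V) {k : ℕ} → ((i : index x) → RankLT (elem x i) k) → RankLE x k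
RankLE-intro (sup I f) rk = rk

RankLE-⊆V : (x : V) {y : V} {k : ℕ} → x ⊆V y → RankLE y k → RankLE x k
RankLE-⊆V (sup I f) x⊆y rk i = RankLE-∈V rk (x⊆y (f i) (elem-∈V (sup I f) i))

module _ {n : ℕ} {P : Pred (Fin n) 0ℓ} (P? : Decidable P) where

  comprehension : Subset n
  comprehension = tabulate (isYes ∘ P?)

  lookup-comprehension : (p : Fin n) → lookup comprehension p ≡ isYes (P? p)
  lookup-comprehension = lookup∘tabulate (isYes ∘ P?)

  ∈-comprehension⁺ : {p : Fin n} → P p → p ∈ comprehension
  ∈-comprehension⁺ {p} Pp =
    lookup⇒[]= p comprehension (trans (lookup-comprehension p) (Equivalence.to T-≡ (fromWitness Pp)))

  ∈-comprehension⁻ : {p : Fin n} → p ∈ comprehension → P p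
  ∈-comprehension⁻ {p} p∈ =
    toWitness (Equivalence.from T-≡ (trans (sym (lookup-comprehension p)) ([]=⇒lookup p∈)))

maxFin-upperBound : (n : ℕ) (g : Fin n → ℕ) (q : Fin n) → g q ≤ maxFin n g
maxFin-upperBound (suc n) g Fin.zero    = m≤m⊔n _ _
maxFin-upperBound (suc n) g (Fin.suc q) =
  ≤-trans (maxFin-upperBound n (g ∘ Fin.suc) q) (m≤n⊔m _ _)

maxSub-upperBound : (n : ℕ) (g : Subset n → ℕ) (B : Subset n) → g B ≤ maxSub n g
maxSub-upperBound zero    g []            = ≤-refl
maxSub-upperBound (suc n) g (outside ∷ B) =
  ≤-trans (maxSub-upperBound n (g ∘ (outside ∷_)) B) (m≤m⊔n _ _)
maxSub-upperBound (suc n) g (inside ∷ B)  =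
  ≤-trans (maxSub-upperBound n (g ∘ (inside ∷_)) B) (m≤n⊔m _ _)

guard-yes : {A : Set} (a? : Dec A) → Irrelevant A → (f : A → ℕ) (a : A) → guard a? f ≡ f a
guard-yes a? irr f a rewrite dec-yes-irr a? irr a = refl

module _ {n : ℕ} {T : Target n} where

  hPlace≤hNode : (B : Subset n) (g : (q : Fin n) → q ∈ B → WFPlace T q)
                 (q : Fin n) (q∈B : q ∈ B) → hPlace (g q q∈B) ≤ hNode (wfNode B g)
  hPlace≤hNode B g q q∈B = ≤-trans
    (≤-reflexive (sym (guard-yes (q ∈? B) []=-irrelevant (hPlace ∘ g q) q∈B)))
    (maxFin-upperBound n _ q)

  hNode<hPlace : (q : Fin n) (f : (B : Subset n) → q ∈ T B → WFNode T B)
                 (B : Subset n) (q∈TB : q ∈ T B) → hNode (f B q∈TB) < hPlace (wfPlace q f)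
  hNode<hPlace q f B q∈TB = s≤s (≤-trans
    (≤-reflexive (sym (guard-yes (q ∈? T B) []=-irrelevant (hNode ∘ f B) q∈TB)))
    (maxSub-upperBound n _ B))

module RankBounds (em : ExcludedMiddle 0ℓ) {n : ℕ} {T : Target n} {σ : Fin n → V}
                  (transitive : IsTransitive σ) (complies : Complies T σ) where

  ∈V-bigUnionNode : {x : V} {p : Fin n} {B : Subset n} →
                    x ∈V σ p → p ∈ B → x ∈V bigUnionNode σ B
  ∈V-bigUnionNode {p = p} (i , x≐) p∈B = (p , p∈B , i) , x≐

  Meets : V → Fin n → Set
  Meets s p = Σ (index s) (λ j → elem s j ∈V σ p)

  meets? : (s : V) → Decidable (Meets s)
  meets? s p = em

  meetingPlaces : V → Subset n
  meetingPlaces s = comprehension (meets? s)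

  ⊆-bigUnion-meetingPlaces : (s : V) → (∃ λ q → s ∈V σ q) →
                             s ⊆V bigUnionNode σ (meetingPlaces s)
  ⊆-bigUnion-meetingPlaces s s∈⋃Σ x (j , x≐sⱼ) =
    let (p , sⱼ∈σp) = transitive s (elem s j) s∈⋃Σ (elem-∈V s j)
    in ∈V-respˡ-≐ (bigUnionNode σ (meetingPlaces s)) x≐sⱼ
         (∈V-bigUnionNode sⱼ∈σp (∈-comprehension⁺ (meets? s) (j , sⱼ∈σp)))

  ∈PStar-meetingPlaces : (s : V) → (∃ λ q → s ∈V σ q) → InPStar σ (meetingPlaces s) s
  ∈PStar-meetingPlaces s s∈⋃Σ =
    ⊆-bigUnion-meetingPlaces s s∈⋃Σ ,
    λ p p∈ → let (j , sⱼ∈σp) = ∈-comprehension⁻ (meets? s) p∈ in elem s j , elem-∈V s j , sⱼ∈σp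

  ∈T-meetingPlaces : (q : Fin n) (s : V) → s ∈V σ q → q ∈ T (meetingPlaces s)
  ∈T-meetingPlaces q s s∈σq =
    Equivalence.from (complies (meetingPlaces s) q) (s , s∈σq , ∈PStar-meetingPlaces s (q , s∈σq))

  mutual
    rank-block : (q : Fin n) (w : WFPlace T q) → RankLE (σ q) (hPlace w)
    rank-block q (wfPlace .q f) = RankLE-intro (σ q) λ i →
      let s = elem (σ q) i
          s∈σq = elem-∈V (σ q) i
          q∈TBₛ = ∈T-meetingPlaces q s s∈σq
      in RankLT-mono s (hNode<hPlace q f (meetingPlaces s) q∈TBₛ)
           (RankLE-⊆V s (⊆-bigUnion-meetingPlaces s (q , s∈σq))
              (rank-bigUnion (meetingPlaces s) (f (meetingPlaces s) q∈TBₛ)))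

    rank-bigUnion : (B : Subset n) (w : WFNode T B) → RankLE (bigUnionNode σ B) (hNode w)
    rank-bigUnion B (wfNode .B g) (q , q∈B , i) =
      RankLT-mono (elem (σ q) i) (hPlace≤hNode B g q q∈B)
        (RankLE-∈V (rank-block q (g q q∈B)) (elem-∈V (σ q) i))

mainTheorem4 : ExcludedMiddle 0ℓ →
    (n : ℕ) (T : Target n) (σ : Fin n → V) →
    IsPartition σ → IsTransitive σ → Complies T σ →
    ((q : Fin n) (w : WFPlace T q) → RankLE (σ q) (hPlace w))
    × ((B : Subset n) (w : WFNode T B) → RankLE (bigUnionNode σ B) (hNode w))
mainTheorem4 em n T σ _ transitive complies = rank-block , rank-bigUnion
  where open RankBounds em {σ = σ} transitive complies
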